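{- Let $n\ge 2$, let $p$ be a non-identity permutation of $[n]$, and let $\Phi(p)$ be the set partition of $[n+1]$ produced by the 5-step map (defined in the context). Then: (i) the block of $\Phi(p)$ containing $n+1$ does not consist of consecutive integers; and (ii) every singleton block $\{a\}$ of $\Phi(p)$ is straddled by a big block of $\Phi(p)$ that is not the penultimate block, i.e. there is a block $B$ with $|B|\ge2$, $\min B<a<\max B$, and $B$ is not the block with the second largest maximum.
   Context: Blocks of a set partition are ordered by increasing maximum; the last block is the one containing the largest element, the penultimate block is the one with the second largest maximum. A singleton block has one element, a big block more than one. The 5-step map: let $p=p_1\cdots p_n$ be a non-identity permutation of $[n]$. Decompose $p$ into its maximal increasing runs $R_1,\dots,R_k$ (left to right; $k\ge2$), regarded as sets, and adjoin $n+1$ to $R_k$. For $j<k$, call $R_j$ an LRMax run if its largest element is a left-to-right maximum of $p$ (larger than every entry of $p$ to its left); $R_k$ is never an LRMax run. Let the LRMax runs be $R_{i_1},\dots,R_{i_m}$ with $1=i_1<\dots<i_m<k$ and let $M_t=\max R_{i_t}$. Color every element of $R_{i_1}\setminus\{M_1\}$ red; for $t\ge2$, color $x\in R_{i_t}\setminus\{M_t\}$ blue if $x<M_{t-1}$ and red if $x>M_{t-1}$. Set $S_t=\{M_t\}\cup\{\text{blue elements of }R_{i_{t+1}}\}$ for $1\le t<m$ and $S_m=\{M_m\}\cup\{\text{all red elements}\}$. Then $\Phi(p)$ is the set partition of $[n+1]$ whose blocks are $S_1,\dots,S_m$ together with the runs $R_j$ for $j\notin\{i_1,\dots,i_m\}$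 (with $n+1\in R_k$). -}

module Defs where

open import Data.Nat using (ℕ; zero; suc; _≤_; _<_; _<ᵇ_; _⊔_; _⊓_; _<?_)
open import Data.Bool using (Bool; true; false; if_then_else_)
open import Data.List using (List; []; _∷_; _++_; map; filter; foldr; length; concat; upTo)
open import Data.List.Membership.Propositional using (_∈_)
open import Data.Product using (_×_; _,_; proj₁; proj₂)
open import Relation.Binary.PropositionalEquality using (_≡_)

range1 : ℕ → List ℕ
range1 n = map suc (upTo n)

consHead : ℕ → List (List ℕ) → List (List ℕ)
consHead x []       = (x ∷ []) ∷ []
consHead x (r ∷ rs) = (x ∷ r) ∷ rs

runsAux : ℕ → List ℕ → List (List ℕ)
runsAux x []       = (x ∷ []) ∷ []
runsAux x (y ∷ ys) =
  if x <ᵇ y then consHead x (runsAux y ys) else (x ∷ []) ∷ runsAux y ys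

runs : List ℕ → List (List ℕ)
runs []       = []
runs (x ∷ xs) = runsAux x xs

lastN : List ℕ → ℕ
lastN []           = 0
lastN (x ∷ [])     = x
lastN (x ∷ y ∷ ys) = lastN (y ∷ ys)

initN : List ℕ → List ℕ
initN []           = []
initN (x ∷ [])     = []
initN (x ∷ y ∷ ys) = x ∷ initN (y ∷ ys)

initR : List (List ℕ) → List (List ℕ)
initR []           = []
initR (x ∷ [])     = []
initR (x ∷ y ∷ ys) = x ∷ initR (y ∷ ys)

lastR : List (List ℕ) → List ℕ
lastR []           = []
lastR (x ∷ [])     = x
lastR (x ∷ y ∷ ys) = lastR (y ∷ ys)

-- Classify the runs R_1 .. R_{k-1}.  q = maximum of all entries of p to the
-- left of the current run (0 initially; entries are ≥ 1).  A run is an LRMax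
-- run iff its maximum (its last entry) exceeds q.  For an LRMax run with
-- maximum M we record (M , blue elements , red elements), where the non-maximal
-- elements x are blue iff x < q (q = M_{t-1}) and red iff x > q (for the first
-- LRMax run q = 0, so all are red).
classify : ℕ → List (List ℕ) → List (ℕ × List ℕ × List ℕ) × List (List ℕ)
classify q [] = [] , []
classify q (R ∷ Rs) =
  if q <ᵇ lastN R
  then ( (lastN R , filter (_<? q) (initN R) , filter (q <?_) (initN R))
           ∷ proj₁ (classify (lastN R) Rs)
       , proj₂ (classify (lastN R) Rs))
  else ( proj₁ (classify q Rs) , R ∷ proj₂ (classify q Rs))

-- S_t = {M_t} ∪ blue(R_{i_{t+1}}) for t < m,  S_m = {M_m} ∪ all red elements
sBlocks : List (ℕ × List ℕ × List ℕ) → List ℕ → List (List ℕ)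
sBlocks [] reds = []
sBlocks ((M , _) ∷ []) reds = (M ∷ reds) ∷ []
sBlocks ((M , _) ∷ (M' , b , r) ∷ rest) reds = (M ∷ b) ∷ sBlocks ((M' , b , r) ∷ rest) reds

allReds : List (ℕ × List ℕ × List ℕ) → List ℕ
allReds ts = concat (map (λ t → proj₂ (proj₂ t)) ts)

-- The 5-step map Φ : permutations of [n] → set partitions of [n+1],
-- a partition being given as a list of blocks (each block a list).
Φ : ℕ → List ℕ → List (List ℕ)
Φ n p =
  let Rs = runs p
      c  = classify 0 (initR Rs)
  in sBlocks (proj₁ c) (allReds (proj₁ c))
     ++ proj₂ c
     ++ ((lastR Rs ++ (suc n ∷ [])) ∷ [])

maxL : List ℕ → ℕ
maxL = foldr _⊔_ 0

minL : List ℕ → ℕ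
minL []       = 0
minL (x ∷ xs) = foldr _⊓_ x xs

Consecutive : List ℕ → Set
Consecutive B = ∀ x y z → x ∈ B → y ∈ B → x ≤ z → z ≤ y → z ∈ B

Straddles : List ℕ → ℕ → Set
Straddles B a = minL B < a × a < maxL B

Penultimate : List (List ℕ) → List ℕ → Set
Penultimate P B = length (filter (λ C → maxL B <? maxL C) P) ≡ 1

module Submission where

-- Let R₁, …, R_k be the maximal increasing runs of p.  As p is not the
-- identity, k ≥ 2, and the last block of Φ(p) is R_k ∪ {n+1}.
--
-- Instead of Φ's three-part layout we use a permutation of it computed in
-- one left-to-right pass over R₁ … R_{k-1} (`stream`), which carries the
-- current LR maximum M and the red elements seen so far; membership and
-- the number of blocks above a given one are invariant under permutation.
-- Walking along the runs maintains a `ScanState`: the processed prefix of p,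
-- its last entry v ≤ M, and the facts that p is duplicate-free with
-- entries in [1, n].  From it we derive:
--  (i)  all stream blocks consist of entries of p, so only R_k ∪ {n+1}
--       contains n+1; the last entry of R_{k-1} is a gap of that block;
--  (ii) a singleton of the stream is either the final S-block {M_m}, which
--       R_k ∪ {n+1} straddles, or a non-LRMax run {a}; then the first later
--       run with head below a and maximum above a (or its S-block, if that
--       run is an LRMax run) straddles a, else R_k ∪ {n+1} does.  The
--       former lies below a later S-block and below R_k ∪ {n+1}, hence is
--       not penultimate; R_k ∪ {n+1} is the topmost block, never penultimate.

open import Defs
open import Data.Nat
open import Data.Nat.Properties
open import Data.Bool using (true; false)
open import Data.Sum using (_⊎_; inj₁; inj₂)
open import Data.Product using (_×_; _,_; proj₁; proj₂; ∃-syntax)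
open import Data.List
open import Data.List.Properties
  using (++-assoc; ++-identityʳ; ∷-injectiveʳ; filter-++; filter-accept; filter-none; length-++; length-map; length-upTo)
open import Data.List.Relation.Unary.All as All using (All; []; _∷_)
import Data.List.Relation.Unary.All.Properties as Allₚ
open import Data.List.Relation.Unary.Any using (here; there)
open import Data.List.Relation.Unary.Linked as Linked using (Linked; []; [-]; _∷_)
import Data.List.Relation.Unary.Linked.Properties as Linkedₚ
open import Data.List.Relation.Unary.AllPairs as AllPairs using (_∷_)
import Data.List.Relation.Unary.AllPairs.Properties as AllPairsₚ
open import Data.List.Relation.Unary.Unique.Propositional using (Unique)
import Data.List.Relation.Unary.Unique.Propositional.Properties as Uniqueₚ
open import Data.List.Membership.Propositional using (_∈_)
open import Data.List.Membership.Propositional.Properties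
  using (∈-++⁺ˡ; ∈-++⁺ʳ; ∈-++⁻; ∈-filter⁺; ∈-map⁻; ∈-upTo⁻)
open import Data.List.Relation.Binary.Pointwise using (Pointwise-≡⇒≡)
open import Data.List.Relation.Binary.Permutation.Propositional
  using (_↭_; prep; ↭-trans; ↭-sym; ↭-reflexive; ↭⇒↭ₛ)
import Data.List.Relation.Binary.Permutation.Propositional.Properties as Perm
import Data.List.Relation.Binary.Permutation.Setoid.Properties as PermSetoid
import Data.List.Relation.Unary.Sorted.TotalOrder.Properties as Sorted
open import Relation.Binary.PropositionalEquality
open import Relation.Nullary using (¬_; yes; no; contradiction)
open import Relation.Nullary.Reflects using (ofʸ; ofⁿ)

-- The first entry of a list (0 on []); `hd R ∈ R` says that R is nonempty.
hd : List ℕ → ℕ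
hd []      = 0
hd (x ∷ _) = x

member⇒length≥1 : ∀ {A : Set} {x : A} xs → x ∈ xs → 1 ≤ length xs
member⇒length≥1 (_ ∷ _) _ = s≤s z≤n

⊓-fold≤ : ∀ y zs {x} → x ∈ y ∷ zs → foldr _⊓_ y zs ≤ x
⊓-fold≤ y []       (here refl)         = ≤-refl
⊓-fold≤ y (z ∷ zs) (here refl)         = ≤-trans (m⊓n≤n z _) (⊓-fold≤ y zs (here refl))
⊓-fold≤ y (z ∷ zs) (there (here refl)) = m⊓n≤m z _
⊓-fold≤ y (z ∷ zs) (there (there x∈)) = ≤-trans (m⊓n≤n z _) (⊓-fold≤ y zs (there x∈))

minL≤ : ∀ {x} B → x ∈ B → minL B ≤ x
minL≤ (y ∷ ys) x∈ = ⊓-fold≤ y ys x∈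

≤maxL : ∀ {x} B → x ∈ B → x ≤ maxL B
≤maxL (y ∷ ys) (here refl) = m≤m⊔n y _
≤maxL (y ∷ ys) (there x∈)  = ≤-trans (≤maxL ys x∈) (m≤n⊔m y _)

maxL≤ : ∀ {k} B → All (_≤ k) B → maxL B ≤ k
maxL≤ []       []         = z≤n
maxL≤ (y ∷ ys) (y≤ ∷ ys≤) = ⊔-lub y≤ (maxL≤ ys ys≤)

straddles : ∀ B {a x y} → x ∈ B → y ∈ B → x < a → a < y → Straddles B a
straddles B x∈ y∈ x<a a<y = ≤-<-trans (minL≤ B x∈) x<a , <-≤-trans a<y (≤maxL B y∈)

distinct : ∀ {x y : ℕ} xs ys → Unique (xs ++ ys) → x ∈ xs → y ∈ ys → x ≢ y
distinct (z ∷ xs) ys (z∉ ∷ _) (here refl) y∈ = All.lookup (Allₚ.++⁻ʳ xs z∉) y∈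
distinct (z ∷ xs) ys (_ ∷ u)  (there x∈)  y∈ = distinct xs ys u x∈ y∈

later-below : ∀ {x y : ℕ} xs ys → Unique (xs ++ ys) → x ∈ xs → y ∈ ys → y ≤ x → y < x
later-below xs ys u x∈ y∈ y≤x = ≤∧≢⇒< y≤x (λ y≡x → distinct xs ys u x∈ y∈ (sym y≡x))

lastN∈ : ∀ R → hd R ∈ R → lastN R ∈ R
lastN∈ (x ∷ [])     _ = here refl
lastN∈ (x ∷ y ∷ ys) _ = there (lastN∈ (y ∷ ys) (here refl))

hd∈initN : ∀ R → hd R < lastN R → hd R ∈ initN R
hd∈initN (x ∷ [])     x<x = contradiction x<x (<-irrefl refl)
hd∈initN (x ∷ y ∷ ys) _   = here refl

hd<lastN⇒length≥2 : ∀ R → hd R < lastN R → 2 ≤ length R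
hd<lastN⇒length≥2 (x ∷ [])     x<x = contradiction x<x (<-irrefl refl)
hd<lastN⇒length≥2 (x ∷ y ∷ ys) _   = s≤s (s≤s z≤n)

initN-All : ∀ {P : ℕ → Set} R → All P R → All P (initN R)
initN-All []           []       = []
initN-All (x ∷ [])     _        = []
initN-All (x ∷ y ∷ ys) (p ∷ ps) = p ∷ initN-All (y ∷ ys) ps

blue red : ℕ → List ℕ → List ℕ
blue q R = filter (_<? q) (initN R)
red  q R = filter (q <?_) (initN R)

record IsRun (R : List ℕ) : Set where
  constructor run
  field
    increasing : Linked _<_ R
    belowLast  : All (_≤ lastN R) R
    nonempty   : hd R ∈ R

open IsRun

singletonRun : ∀ x → IsRun (x ∷ [])
singletonRun x = run [-] (≤-refl ∷ []) (here refl)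

extendRun : ∀ {x y r} → x < y → IsRun (y ∷ r) → IsRun (x ∷ y ∷ r)
extendRun x<y (run inc (y≤ ∷ bd) _) = run (x<y ∷ inc) (≤-trans (<⇒≤ x<y) y≤ ∷ y≤ ∷ bd) (here refl)

data RunSeq : List (List ℕ) → Set where
  single : ∀ {R} → IsRun R → RunSeq (R ∷ [])
  step   : ∀ {R S Ss} → IsRun R → hd S ≤ lastN R → RunSeq (S ∷ Ss) → RunSeq (R ∷ S ∷ Ss)

extendSeq : ∀ {x y r rs} → x < y → RunSeq ((y ∷ r) ∷ rs) → RunSeq ((x ∷ y ∷ r) ∷ rs)
extendSeq x<y (single R)      = single (extendRun x<y R)
extendSeq x<y (step R hd≤ Rs) = step (extendRun x<y R) hd≤ Rs

data RunsOf (x : ℕ) (xs : List ℕ) : List (List ℕ) → Set where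
  runsOf : ∀ r rs → RunSeq ((x ∷ r) ∷ rs) → concat ((x ∷ r) ∷ rs) ≡ x ∷ xs → RunsOf x xs ((x ∷ r) ∷ rs)

runsAux-runs : ∀ x xs → RunsOf x xs (runsAux x xs)
runsAux-runs x [] = runsOf [] [] (single (singletonRun x)) refl
runsAux-runs x (y ∷ ys) with x <ᵇ y | <ᵇ-reflects-< x y | runsAux y ys | runsAux-runs y ys
... | true  | ofʸ x<y | _ | runsOf r rs sq cc =
  runsOf (y ∷ r) rs (extendSeq x<y sq) (cong (x ∷_) cc)
... | false | ofⁿ x≮y | _ | runsOf r rs sq cc =
  runsOf [] ((y ∷ r) ∷ rs) (step (singletonRun x) (≮⇒≥ x≮y) sq) (cong (x ∷_) cc)

-- `Chain v Rs L`: Rs ++ [L] are consecutive runs, the first one starting at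
-- or below v (of the final run L only its nonemptiness is recorded).
data Chain (v : ℕ) : List (List ℕ) → List ℕ → Set where
  end  : ∀ {L} → hd L ≤ v → hd L ∈ L → Chain v [] L
  link : ∀ {R Rs L} → hd R ≤ v → IsRun R → Chain (lastN R) Rs L → Chain v (R ∷ Rs) L

seq⇒chain : ∀ R S Ss → RunSeq (R ∷ S ∷ Ss) → IsRun R × Chain (lastN R) (initR (S ∷ Ss)) (lastR (S ∷ Ss))
seq⇒chain R S []       (step runR hd≤ (single runS)) = runR , end hd≤ (nonempty runS)
seq⇒chain R S (T ∷ Ts) (step runR hd≤ sq)            = runR , link hd≤ (proj₁ rest) (proj₂ rest)
  where rest = seq⇒chain S T Ts sq

concat-initR-lastR : ∀ (S : List ℕ) Ss → concat (initR (S ∷ Ss)) ++ lastR (S ∷ Ss) ≡ concat (S ∷ Ss)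
concat-initR-lastR S []       = sym (++-identityʳ S)
concat-initR-lastR S (T ∷ Ts) =
  trans (++-assoc S (concat (initR (T ∷ Ts))) (lastR (T ∷ Ts))) (cong (S ++_) (concat-initR-lastR T Ts))

-- Blocks of Φ(p) other than the last, in the order they are closed while
-- reading the runs: an LRMax run R closes the S-block {M} ∪ blue(R) of the
-- previous LR maximum M, a non-LRMax run is a block, and at the end the
-- last LR maximum collects all red entries.
stream : ℕ → List ℕ → List (List ℕ) → List (List ℕ)
stream M reds []       = (M ∷ reds) ∷ []
stream M reds (R ∷ Rs) with M <ᵇ lastN R
... | true  = (M ∷ blue M R) ∷ stream (lastN R) (reds ++ red M R) Rs
... | false = R ∷ stream M reds Rs

-- `classify` followed by `sBlocks` lists the same blocks as `stream`, when
-- the pending LRMax triple has maximum M and `reds` were seen before.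
classify-stream : ∀ M b r reds Rs →
  let c = classify M Rs in
  sBlocks ((M , b , r) ∷ proj₁ c) (reds ++ allReds (proj₁ c)) ++ proj₂ c ↭ stream M reds Rs
classify-stream M b r reds [] rewrite ++-identityʳ reds = ↭-reflexive refl
classify-stream M b r reds (R ∷ Rs) with M <ᵇ lastN R
... | true  rewrite sym (++-assoc reds (red M R) (allReds (proj₁ (classify (lastN R) Rs)))) =
  prep _ (classify-stream (lastN R) (blue M R) (red M R) (reds ++ red M R) Rs)
... | false =
  ↭-trans (Perm.shift R (sBlocks ((M , b , r) ∷ proj₁ c) (reds ++ allReds (proj₁ c))) (proj₂ c))
          (prep R (classify-stream M b r reds Rs))
  where c = classify M Rs

lastBlock : ℕ → List ℕ → List ℕ
lastBlock n L = L ++ suc n ∷ []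

-- Φ(p) is the stream started after the first run R₁ (always an LRMax run),
-- followed by the last block.
Φ-stream : ∀ n p R₁ S Ss → runs p ≡ R₁ ∷ S ∷ Ss → 0 < lastN R₁ →
  Φ n p ↭ stream (lastN R₁) (red 0 R₁) (initR (S ∷ Ss)) ++ lastBlock n (lastR (S ∷ Ss)) ∷ []
Φ-stream n p R₁ S Ss eq pos rewrite eq with 0 <ᵇ lastN R₁ | <ᵇ-reflects-< 0 (lastN R₁)
... | true  | _      =
  ↭-trans (↭-reflexive (sym (++-assoc (sBlocks (t₁ ∷ proj₁ c) (red 0 R₁ ++ allReds (proj₁ c))) (proj₂ c) _)))
          (Perm.++⁺ʳ _ (classify-stream (lastN R₁) (blue 0 R₁) (red 0 R₁) (red 0 R₁) (initR (S ∷ Ss))))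
  where
  t₁ = (lastN R₁ , blue 0 R₁ , red 0 R₁)
  c  = classify (lastN R₁) (initR (S ∷ Ss))
... | false | ofⁿ ¬pos = contradiction pos ¬pos

stream-reaches : ∀ M reds Rs → ∃[ C ] (C ∈ stream M reds Rs × M ≤ maxL C)
stream-reaches M reds [] = M ∷ reds , here refl , ≤maxL (M ∷ reds) (here refl)
stream-reaches M reds (R ∷ Rs) with M <ᵇ lastN R | <ᵇ-reflects-< M (lastN R)
... | true | ofʸ M<last with stream-reaches (lastN R) (reds ++ red M R) Rs
...   | C , C∈ , last≤ = C , there C∈ , ≤-trans (<⇒≤ M<last) last≤
stream-reaches M reds (R ∷ Rs) | false | _ with stream-reaches M reds Rs
...   | C , C∈ , M≤ = C , there C∈ , M≤

-- State after reading the prefix `done` of p, with Rs ++ [L] still unread: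
-- v is the last entry read and M the current LR maximum; p = done ++ the
-- unread runs is duplicate-free with entries ≤ n; the reds seen are ≤ n.
record ScanState (n : ℕ) (done : List ℕ) (v M : ℕ) (reds : List ℕ) (Rs : List (List ℕ)) (L : List ℕ) : Set where
  field
    chain           : Chain v Rs L
    v≤M             : v ≤ M
    v∈done          : v ∈ done
    M∈done          : M ∈ done
    distinctEntries : Unique (done ++ concat Rs ++ L)
    entries≤n       : All (_≤ n) (done ++ concat Rs ++ L)
    reds≤n          : All (_≤ n) reds

  unread-below : ∀ {x y} → x ∈ done → y ∈ concat Rs ++ L → y ≤ x → y < x
  unread-below = later-below done (concat Rs ++ L) distinctEntries

  M≤n : M ≤ n
  M≤n = All.lookup entries≤n (∈-++⁺ˡ M∈done)

  v≤n : v ≤ n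
  v≤n = ≤-trans v≤M M≤n

open ScanState

blue≤ : ∀ q R → All (_≤ q) (blue q R)
blue≤ q R = All.map <⇒≤ (Allₚ.all-filter (_<? q) (initN R))

module _ {n done v M reds R Rs L} (S : ScanState n done v M reds (R ∷ Rs) L) where

  nextRun : IsRun R
  nextRun with chain S
  ... | link _ runR _ = runR

  hd≤v : hd R ≤ v
  hd≤v with chain S
  ... | link hd≤ _ _ = hd≤

  run-below : ∀ {x y} → x ∈ done → y ∈ R → y ≤ x → y < x
  run-below x∈ y∈ = unread-below S x∈ (∈-++⁺ˡ (∈-++⁺ˡ y∈))

  run≤n : All (_≤ n) R
  run≤n = Allₚ.++⁻ˡ R (Allₚ.++⁻ˡ (R ++ concat Rs) (Allₚ.++⁻ʳ done (entries≤n S)))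

  hd<read : ∀ {a} → a ∈ done → v ≤ a → hd R < a
  hd<read a∈ v≤a = run-below a∈ (nonempty nextRun) (≤-trans hd≤v v≤a)

  -- if R is an LRMax run, its head is blue, so {M} ∪ blue(R) is big
  hd∈blue : M < lastN R → hd R ∈ blue M R
  hd∈blue M<last = ∈-filter⁺ (_<? M) (hd∈initN R (<-trans hd<M M<last)) hd<M
    where hd<M = hd<read (M∈done S) (v≤M S)

  private
    regroup : done ++ (R ++ concat Rs) ++ L ≡ (done ++ R) ++ (concat Rs ++ L)
    regroup = trans (cong (done ++_) (++-assoc R (concat Rs) L)) (sym (++-assoc done R (concat Rs ++ L)))

  advance : ∀ M' reds' → lastN R ≤ M' → M' ∈ done ++ R → All (_≤ n) reds' →
            ScanState n (done ++ R) (lastN R) M' reds' Rs L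
  advance M' reds' last≤ M'∈ reds'≤n with chain S
  ... | link _ runR ch = record
    { chain           = ch
    ; v≤M             = last≤
    ; v∈done          = ∈-++⁺ʳ done (lastN∈ R (nonempty runR))
    ; M∈done          = M'∈
    ; distinctEntries = subst Unique regroup (distinctEntries S)
    ; entries≤n       = subst (All (_≤ n)) regroup (entries≤n S)
    ; reds≤n          = reds'≤n
    }

  passLRMax : ScanState n (done ++ R) (lastN R) (lastN R) (reds ++ red M R) Rs L
  passLRMax = advance (lastN R) (reds ++ red M R) ≤-refl
    (∈-++⁺ʳ done (lastN∈ R (nonempty nextRun)))
    (Allₚ.++⁺ (reds≤n S) (Allₚ.filter⁺ (M <?_) (initN-All R run≤n)))

  passOther : lastN R ≤ M → ScanState n (done ++ R) (lastN R) M reds Rs L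
  passOther last≤M = advance M reds last≤M (∈-++⁺ˡ (M∈done S)) (reds≤n S)

stream-bounded : ∀ {n done v M reds} Rs L → ScanState n done v M reds Rs L →
                 ∀ {C} → C ∈ stream M reds Rs → All (_≤ n) C
stream-bounded [] L S (here refl) = M≤n S ∷ reds≤n S
stream-bounded {M = M} (R ∷ Rs) L S C∈ with M <ᵇ lastN R | <ᵇ-reflects-< M (lastN R)
stream-bounded {M = M} (R ∷ Rs) L S (here refl) | true  | _ =
  M≤n S ∷ Allₚ.filter⁺ (_<? M) (initN-All R (run≤n S))
stream-bounded (R ∷ Rs) L S (there C∈) | true  | _ = stream-bounded Rs L (passLRMax S) C∈
stream-bounded (R ∷ Rs) L S (here refl) | false | _ = run≤n S
stream-bounded (R ∷ Rs) L S (there C∈) | false | ofⁿ M≮last =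
  stream-bounded Rs L (passOther S (≮⇒≥ M≮last)) C∈

-- The witness for part (ii) in bs ++ [lastBlock n L]: a big block
-- straddling a that is either the last block, or a block of bs lying
-- below another block of bs (so that two blocks lie above it).
Straddler : ℕ → List (List ℕ) → List ℕ → ℕ → Set
Straddler n bs L a =
  ∃[ B ] ((B ≡ lastBlock n L ⊎ (B ∈ bs × ∃[ C ] (C ∈ bs × maxL B < maxL C)))
          × 2 ≤ length B × Straddles B a)

straddler-∷ : ∀ {n bs L a} X → Straddler n bs L a → Straddler n (X ∷ bs) L a
straddler-∷ X (B , inj₁ B≡ , big)                = B , inj₁ B≡ , big
straddler-∷ X (B , inj₂ (B∈ , C , C∈ , B<C) , big) = B , inj₂ (there B∈ , C , there C∈ , B<C) , big

head-straddler : ∀ {n L a} B M' reds' Rs → maxL B < M' → 2 ≤ length B → Straddles B a →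
                 Straddler n (B ∷ stream M' reds' Rs) L a
head-straddler B M' reds' Rs B<M' big str with stream-reaches M' reds' Rs
... | C , C∈ , M'≤C = B , inj₂ (here refl , C , there C∈ , <-≤-trans B<M' M'≤C) , big , str

lastBlock-big : ∀ n L → hd L ∈ L → 2 ≤ length (lastBlock n L)
lastBlock-big n (x ∷ xs) _ = s≤s (member⇒length≥1 (xs ++ suc n ∷ []) (∈-++⁺ʳ xs (here refl)))

last-straddler : ∀ {n bs a} L → hd L ∈ L → hd L < a → a ≤ n → Straddler n bs L a
last-straddler {n} L hd∈ hd<a a≤n =
  lastBlock n L , inj₁ refl , lastBlock-big n L hd∈ ,
  straddles (lastBlock n L) (∈-++⁺ˡ hd∈) (∈-++⁺ʳ L (here refl)) hd<a (s≤s a≤n)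

-- A read entry a with v ≤ a < M, such as a non-LRMax singleton, is
-- straddled by the first later run reaching above a (or by its S-block if
-- that run is an LRMax run), or else by the last block.
scan : ∀ {n done v M reds} Rs L a → ScanState n done v M reds Rs L → v ≤ a → a < M → a ∈ done →
       Straddler n (stream M reds Rs) L a
scan [] L a S v≤a a<M a∈ with chain S
... | end hd≤v hd∈ = last-straddler L hd∈ (unread-below S a∈ hd∈ (≤-trans hd≤v v≤a)) (<⇒≤ (<-≤-trans a<M (M≤n S)))
scan {M = M} {reds} (R ∷ Rs) L a S v≤a a<M a∈ with M <ᵇ lastN R | <ᵇ-reflects-< M (lastN R)
... | true | ofʸ M<last =
  head-straddler B (lastN R) _ Rs (≤-<-trans (maxL≤ B (≤-refl ∷ blue≤ M R)) M<last)
    (s≤s (member⇒length≥1 _ hd∈B)) (straddles B (there hd∈B) (here refl) (hd<read S a∈ v≤a) a<M)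
  where
  B    = M ∷ blue M R
  hd∈B = hd∈blue S M<last
... | false | ofⁿ M≮last with lastN R ≤? a
...   | yes last≤a = straddler-∷ R (scan Rs L a (passOther S (≮⇒≥ M≮last)) last≤a a<M (∈-++⁺ˡ a∈))
...   | no  last≰a =
  head-straddler R M reds Rs (≤-<-trans (maxL≤ R (belowLast runR)) last<M)
    (hd<lastN⇒length≥2 R (<-trans hd<a a<last)) (straddles R (nonempty runR) last∈ hd<a a<last)
  where
  runR   = nextRun S
  last∈  = lastN∈ R (nonempty runR)
  hd<a   = hd<read S a∈ v≤a
  a<last = ≰⇒> last≰a
  last<M = run-below S (M∈done S) last∈ (≮⇒≥ M≮last)

-- Every singleton block of the stream has a straddler: the final S-block
-- {M} is straddled by the last block, an S-block closed by an LRMax run is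
-- never a singleton, and a non-LRMax singleton run is handled by `scan`.
singleton-straddler : ∀ {n done v M reds} Rs L → ScanState n done v M reds Rs L →
                      ∀ a → (a ∷ []) ∈ stream M reds Rs → Straddler n (stream M reds Rs) L a
singleton-straddler [] L S a (here refl) with chain S
... | end hd≤v hd∈ = last-straddler L hd∈ (unread-below S (M∈done S) hd∈ (≤-trans hd≤v (v≤M S))) (M≤n S)
singleton-straddler {M = M} (R ∷ Rs) L S a a∈ with M <ᵇ lastN R | <ᵇ-reflects-< M (lastN R)
singleton-straddler (R ∷ Rs) L S a (here a≡) | true | ofʸ M<last =
  contradiction (subst (hd R ∈_) (sym (∷-injectiveʳ a≡)) (hd∈blue S M<last)) λ ()
singleton-straddler (R ∷ Rs) L S a (there a∈) | true | _ =
  straddler-∷ _ (singleton-straddler Rs L (passLRMax S) a a∈)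
singleton-straddler (R ∷ Rs) L S a (here refl) | false | ofⁿ M≮last =
  straddler-∷ R (scan Rs L a (passOther S last≤M) ≤-refl (run-below S (M∈done S) (here refl) last≤M)
                      (∈-++⁺ʳ _ (here refl)))
  where last≤M = ≮⇒≥ M≮last
singleton-straddler (R ∷ Rs) L S a (there a∈) | false | ofⁿ M≮last =
  straddler-∷ R (singleton-straddler Rs L (passOther S (≮⇒≥ M≮last)) a a∈)

-- Part (i) for the last block: the last entry v of the earlier runs lies
-- between the head of L and n+1, but not in L ∪ {n+1}.
last-block-gap : ∀ {n done v M reds} Rs L → ScanState n done v M reds Rs L → ¬ Consecutive (lastBlock n L)
last-block-gap (R ∷ Rs) L S = last-block-gap Rs L (passLRMax S)
last-block-gap {n} {v = v} [] L S consec with chain S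
... | end hd≤v hd∈
  with ∈-++⁻ L (consec (hd L) (suc n) v (∈-++⁺ˡ hd∈) (∈-++⁺ʳ L (here refl)) hd≤v (m≤n⇒m≤1+n (v≤n S)))
...   | inj₁ v∈L        = distinct _ L (distinctEntries S) (v∈done S) v∈L refl
...   | inj₂ (here v≡) = 1+n≰n (subst (_≤ n) v≡ (v≤n S))

penultimate-↭ : ∀ {F G} B → F ↭ G → Penultimate F B → Penultimate G B
penultimate-↭ B σ pen = trans (sym (Perm.↭-length (Perm.filter-↭ (λ C → maxL B <? maxL C) σ))) pen

top-not-penultimate : ∀ bs T → All (λ C → maxL C ≤ maxL T) bs → ¬ Penultimate (bs ++ T ∷ []) T
top-not-penultimate bs T bs≤T pen = 0≢1+n (trans (sym (cong length nothing-above)) pen)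
  where
  nothing-above : filter (λ C → maxL T <? maxL C) (bs ++ T ∷ []) ≡ []
  nothing-above = filter-none _ (Allₚ.++⁺ (All.map ≤⇒≯ bs≤T) (<-irrefl refl ∷ []))

below-not-penultimate : ∀ bs T B {C} → C ∈ bs → maxL B < maxL C → maxL B < maxL T →
                        ¬ Penultimate (bs ++ T ∷ []) B
below-not-penultimate bs T B C∈ B<C B<T pen =
  <-irrefl refl (subst (2 ≤_) (trans (sym count) pen) (+-monoˡ-≤ 1 C-above))
  where
  P? = λ C → maxL B <? maxL C
  C-above : 1 ≤ length (filter P? bs)
  C-above = member⇒length≥1 _ (∈-filter⁺ P? C∈ B<C)
  count : length (filter P? (bs ++ T ∷ [])) ≡ length (filter P? bs) + 1
  count = begin
    length (filter P? (bs ++ T ∷ []))          ≡⟨ cong length (filter-++ P? bs (T ∷ [])) ⟩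
    length (filter P? bs ++ filter P? (T ∷ [])) ≡⟨ length-++ (filter P? bs) ⟩
    length (filter P? bs) + length (filter P? (T ∷ []))
      ≡⟨ cong (λ ys → length (filter P? bs) + length ys) (filter-accept P? {x = T} {xs = []} B<T) ⟩
    length (filter P? bs) + 1                   ∎
    where open ≡-Reasoning

module _ {n done v M reds Rs L F}
         (σ : F ↭ stream M reds Rs ++ lastBlock n L ∷ [])
         (S : ScanState n done v M reds Rs L) where

  private
    blocks = stream M reds Rs
    top    = lastBlock n L

    in-F : ∀ {B} → B ∈ blocks ++ top ∷ [] → B ∈ F
    in-F = Perm.∈-resp-↭ (↭-sym σ)

    located : ∀ {B} → B ∈ F → B ∈ blocks ⊎ B ≡ top
    located B∈ with ∈-++⁻ blocks (Perm.∈-resp-↭ σ B∈)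
    ... | inj₁ B∈s       = inj₁ B∈s
    ... | inj₂ (here B≡) = inj₂ B≡

    below-top : ∀ {C} → C ∈ blocks → maxL C < maxL top
    below-top C∈ = <-≤-trans (s≤s (maxL≤ _ (stream-bounded Rs L S C∈))) (≤maxL top (∈-++⁺ʳ L (here refl)))

    L-nonempty : ∀ {w Rs'} → Chain w Rs' L → hd L ∈ L
    L-nonempty (end _ hd∈)  = hd∈
    L-nonempty (link _ _ c) = L-nonempty c

  -- (i): only the last block contains n+1, and it has a gap.
  n+1-block-not-consecutive : ∀ B → B ∈ F → suc n ∈ B → ¬ Consecutive B
  n+1-block-not-consecutive B B∈ n+1∈ with located B∈
  ... | inj₁ B∈s = contradiction (All.lookup (stream-bounded Rs L S B∈s) n+1∈) 1+n≰n
  ... | inj₂ refl = last-block-gap Rs L S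

  singleton-straddled : ∀ a → (a ∷ []) ∈ F →
    ∃[ B ] (B ∈ F × 2 ≤ length B × Straddles B a × ¬ Penultimate F B)
  singleton-straddled a a∈ with located a∈
  ... | inj₂ a≡top =
    contradiction (subst (λ B → 2 ≤ length B) (sym a≡top) (lastBlock-big n L (L-nonempty (chain S)))) λ { (s≤s ()) }
  ... | inj₁ a∈s with singleton-straddler Rs L S a a∈s
  ...   | B , inj₁ refl , big , str =
    top , in-F (∈-++⁺ʳ blocks (here refl)) , big , str ,
    λ pen → top-not-penultimate blocks top (All.tabulate (λ C∈ → <⇒≤ (below-top C∈))) (penultimate-↭ top σ pen)
  ...   | B , inj₂ (B∈ , C , C∈ , B<C) , big , str =
    B , in-F (∈-++⁺ˡ B∈) , big , str ,
    λ pen → below-not-penultimate blocks top B C∈ B<C (below-top B∈) (penultimate-↭ B σ pen)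

range1-increasing : ∀ n → AllPairs.AllPairs _<_ (range1 n)
range1-increasing n = AllPairsₚ.map⁺ (AllPairsₚ.applyUpTo⁺₁ (λ i → i) n (λ i<j _ → s≤s i<j))

↭range1⇒unique : ∀ {n p} → p ↭ range1 n → Unique p
↭range1⇒unique {n} σ =
  PermSetoid.Unique-resp-↭ (setoid ℕ) (↭⇒↭ₛ (↭-sym σ)) (Uniqueₚ.map⁺ suc-injective (Uniqueₚ.upTo⁺ n))

↭range1⇒bounds : ∀ {n p x} → p ↭ range1 n → x ∈ p → 0 < x × x ≤ n
↭range1⇒bounds σ x∈ with ∈-map⁻ suc (Perm.∈-resp-↭ σ x∈)
... | i , i∈ , refl = s≤s z≤n , ∈-upTo⁻ i∈

increasing⇒range1 : ∀ n p → Linked _<_ p → p ↭ range1 n → p ≡ range1 n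
increasing⇒range1 n p inc σ = Pointwise-≡⇒≡
  (Sorted.↗↭↗⇒≋ ≤-totalOrder (Linked.map <⇒≤ inc)
    (Linkedₚ.AllPairs⇒Linked (AllPairs.map <⇒≤ (range1-increasing n))) (↭⇒↭ₛ σ))

initial-state : ∀ {n} R₁ S Ss → RunSeq (R₁ ∷ S ∷ Ss) → Unique (concat (R₁ ∷ S ∷ Ss)) →
  All (_≤ n) (concat (R₁ ∷ S ∷ Ss)) →
  ScanState n R₁ (lastN R₁) (lastN R₁) (red 0 R₁) (initR (S ∷ Ss)) (lastR (S ∷ Ss))
initial-state R₁ S Ss sq u bd = record
  { chain           = proj₂ runs₁
  ; v≤M             = ≤-refl
  ; v∈done          = last∈
  ; M∈done          = last∈
  ; distinctEntries = subst Unique regroup u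
  ; entries≤n       = subst (All _) regroup bd
  ; reds≤n          = Allₚ.filter⁺ (0 <?_) (initN-All R₁ (Allₚ.++⁻ˡ R₁ bd))
  }
  where
  runs₁ = seq⇒chain R₁ S Ss sq
  last∈ = lastN∈ R₁ (nonempty (proj₁ runs₁))
  regroup : concat (R₁ ∷ S ∷ Ss) ≡ R₁ ++ concat (initR (S ∷ Ss)) ++ lastR (S ∷ Ss)
  regroup = cong (R₁ ++_) (sym (concat-initR-lastR S Ss))

Conclusion : ℕ → List ℕ → Set
Conclusion n p =
  (∀ B → B ∈ Φ n p → suc n ∈ B → ¬ Consecutive B)
  × (∀ a → (a ∷ []) ∈ Φ n p → ∃[ B ] (B ∈ Φ n p × 2 ≤ length B × Straddles B a × ¬ Penultimate (Φ n p) B))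

-- The theorem for p = x ∷ xs, given the runs Rs of p.  A single run would
-- make p increasing, hence the identity; otherwise Φ(p) is the stream after
-- the first run followed by the last block, so the stream results apply.
conclusion-from-runs : ∀ n x xs Rs → runsAux x xs ≡ Rs → RunsOf x xs Rs →
  (x ∷ xs) ↭ range1 n → (x ∷ xs) ≢ range1 n → Conclusion n (x ∷ xs)
conclusion-from-runs n x xs _ _ (runsOf r [] (single run₁) cc) σ p≢id =
  contradiction (increasing⇒range1 n _ (subst (Linked _<_) p≡R₁ (increasing run₁)) σ) p≢id
  where p≡R₁ = trans (sym (++-identityʳ (x ∷ r))) cc
conclusion-from-runs n x xs _ runs≡ (runsOf r (S ∷ Ss) sq cc) σ p≢id =
  n+1-block-not-consecutive σΦ S₀ , singleton-straddled σΦ S₀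
  where
  R₁ = x ∷ r
  entry-bounds : ∀ {y} → y ∈ concat (R₁ ∷ S ∷ Ss) → 0 < y × y ≤ n
  entry-bounds {y} y∈ = ↭range1⇒bounds σ (subst (y ∈_) cc y∈)
  S₀ = initial-state R₁ S Ss sq (subst Unique (sym cc) (↭range1⇒unique σ))
         (All.tabulate (λ y∈ → proj₂ (entry-bounds y∈)))
  σΦ = Φ-stream n (x ∷ xs) R₁ S Ss runs≡ (proj₁ (entry-bounds (∈-++⁺ˡ (lastN∈ R₁ (here refl)))))

-- The empty list permutes [n] only for n = 0; otherwise split p into runs.
lemma3 : (n : ℕ) → 2 ≤ n → (p : List ℕ) → p ↭ range1 n → p ≢ range1 n →
    (∀ B → B ∈ Φ n p → suc n ∈ B → ¬ Consecutive B)
    × (∀ a → (a ∷ []) ∈ Φ n p →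
         ∃[ B ] (B ∈ Φ n p × 2 ≤ length B × Straddles B a × ¬ Penultimate (Φ n p) B))
lemma3 n 2≤n [] σ _ = contradiction (subst (2 ≤_) n≡0 2≤n) λ ()
  where
  n≡0 : n ≡ 0
  n≡0 = trans (sym (trans (length-map suc (upTo n)) (length-upTo n))) (sym (Perm.↭-length σ))
lemma3 n _ (x ∷ xs) σ p≢id = conclusion-from-runs n x xs _ refl (runsAux-runs x xs) σ p≢id
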